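{- Let $G$ be an $s$-regular graph with $\xi(G)<\infty$. Suppose there is a 2-factorization $\mathcal F$ realizing $\xi(G)$ (i.e. a 2-factorization of $G$ with $o(\mathcal F)=\xi(G)$ if $s$ is even, or a 2-factorization of $G-F_1$ for some 1-factor $F_1$ with $o(\mathcal F)=\xi(G)$ if $s$ is odd) such that one single 2-factor of $\mathcal F$ contains all $\xi(G)$ odd cycles of $\mathcal F$. Then $\chi'(G)\le s+1$.
   Context: Graphs are finite, connected, may have multiple edges but no loops. $\chi'(G)$ is the chromatic index. A 2-factorization of a $2n$-regular graph is a decomposition of its edge set into $n$ edge-disjoint 2-factors (spanning 2-regular subgraphs). For a 2-factorization $\mathcal F$, $o(\mathcal F)$ is the number of odd cycles in the 2-factors of $\mathcal F$. The oddness of an $s$-regular graph $G$ is: $\xi(G)=\min\{o(\mathcal F):\mathcal F \text{ a 2-factorization of } G\}$ if $s$ is even; $\xi(G)=\min\{\xi(G-F_1): F_1 \text{ a 1-factor of } G\}$ if $s$ is odd and $G$ has a 1-factor; and $\xi(G)=\infty$ otherwise. -}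

module Defs where

open import Data.Nat using (ℕ; zero; suc; _+_; _≤_; _%_; _≡ᵇ_)
open import Data.Bool using (Bool; true; false; if_then_else_)
open import Data.Fin using (Fin; zero; suc; _≟_)
import Data.Maybe.Properties
open import Data.Maybe using (Maybe; just; nothing)
open import Data.Product using (Σ; _×_; _,_; proj₁; proj₂; ∃)
open import Data.Sum using (_⊎_)
open import Relation.Nullary using (¬_)
open import Relation.Nullary.Decidable using (⌊_⌋)
open import Relation.Binary.PropositionalEquality using (_≡_; _≢_)

count : ∀ {k} → (Fin k → Bool) → ℕ
count {zero} p = 0
count {suc k} p = (if p zero then 1 else 0) + count (λ i → p (suc i))

sumFin : ∀ {k} → (Fin k → ℕ) → ℕ
sumFin {zero} f = 0
sumFin {suc k} f = f zero + sumFin (λ i → f (suc i))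

record Graph : Set where
  field
    n : ℕ
    m : ℕ
    ends : Fin m → Fin n × Fin n
    noLoop : ∀ e → proj₁ (ends e) ≢ proj₂ (ends e)
open Graph public

EdgeSet : Graph → Set
EdgeSet G = Fin (m G) → Bool

incidentB : (G : Graph) → Fin (n G) → Fin (m G) → Bool
incidentB G v e = ⌊ proj₁ (ends G e) ≟ v ⌋ Data.Bool.∨ ⌊ proj₂ (ends G e) ≟ v ⌋

Incident : (G : Graph) → Fin (n G) → Fin (m G) → Set
Incident G v e = proj₁ (ends G e) ≡ v ⊎ proj₂ (ends G e) ≡ v

degIn : (G : Graph) → EdgeSet G → Fin (n G) → ℕ
degIn G P v = count (λ e → P e Data.Bool.∧ incidentB G v e)

allEdges : (G : Graph) → EdgeSet G
allEdges G e = true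

Regular : Graph → ℕ → Set
Regular G s = ∀ v → degIn G (allEdges G) v ≡ s

data Reach (G : Graph) (P : EdgeSet G) : Fin (n G) → Fin (n G) → Set where
  here : ∀ {v} → Reach G P v v
  step : ∀ {u w v} (e : Fin (m G)) → P e ≡ true →
         ((proj₁ (ends G e) ≡ u × proj₂ (ends G e) ≡ w) ⊎
          (proj₂ (ends G e) ≡ u × proj₁ (ends G e) ≡ w)) →
         Reach G P w v → Reach G P u v

Connected : Graph → Set
Connected G = ∀ u v → Reach G (allEdges G) u v

IsTwoFactor : (G : Graph) → EdgeSet G → Set
IsTwoFactor G P = ∀ v → degIn G P v ≡ 2

IsOneFactor : (G : Graph) → EdgeSet G → Set
IsOneFactor G P = ∀ v → degIn G P v ≡ 1

record ComponentLabelling (G : Graph) (P : EdgeSet G) (j : ℕ) : Set where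
  field
    label : Fin (n G) → Fin j
    onto : ∀ i → ∃ λ v → label v ≡ i
    sound : ∀ u v → label u ≡ label v → Reach G P u v
    complete : ∀ u v → Reach G P u v → label u ≡ label v
open ComponentLabelling public

oddClasses : ∀ {G P j} → ComponentLabelling G P j → ℕ
oddClasses {G} {P} {j} c =
  count (λ i → (count (λ v → ⌊ label c v ≟ i ⌋) % 2) ≡ᵇ 1)

-- the spanning subgraph (V, P) has exactly k odd components
-- (for a 2-factor: exactly k odd cycles)
NumOddCycles : (G : Graph) → EdgeSet G → ℕ → Set
NumOddCycles G P k = Σ ℕ λ j → Σ (ComponentLabelling G P j) λ c → oddClasses c ≡ k

-- A 2-factorization of G (s even) or of G - F₁ for a 1-factor F₁ (s odd):
-- each edge gets `just i` (in 2-factor i) or `nothing` (in F₁).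
record Factorization (G : Graph) (s : ℕ) : Set where
  field
    r : ℕ
    assign : Fin (m G) → Maybe (Fin r)
    factors2 : ∀ i → IsTwoFactor G (λ e → ⌊ Data.Maybe.Properties.≡-dec _≟_ (assign e) (just i) ⌋)
    rest : (s % 2 ≡ 0 × (∀ e → assign e ≢ nothing)) ⊎
           (s % 2 ≡ 1 × IsOneFactor G (λ e → Data.Maybe.is-nothing (assign e)))
open Factorization public

factor : ∀ {G s} (F : Factorization G s) → Fin (r F) → EdgeSet G
factor {G} F i e = ⌊ Data.Maybe.Properties.≡-dec _≟_ (assign F e) (just i) ⌋

OddTotal : ∀ {G s} → Factorization G s → ℕ → Set
OddTotal {G} F k = Σ (Fin (r F) → ℕ) λ ks →
  (∀ i → NumOddCycles G (factor F i) (ks i)) × sumFin ks ≡ k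

EdgeColourable : Graph → ℕ → Set
EdgeColourable G c = Σ (Fin (m G) → Fin c) λ col →
  ∀ e e' → e ≢ e' → (∃ λ v → Incident G v e × Incident G v e') → col e ≢ col e'

-- All odd cycles of F lie in the 2-factor F i₀, so every other 2-factor is a disjoint union of
-- even cycles and has a proper 2-edge-colouring, while F i₀ (whose line graph has maximum degree 2)
-- is greedily 3-edge-colourable. Give each of the r 2-factors its own pair of colours, one spare
-- colour to F i₀ and, when s is odd, one more colour to the 1-factor F₁: since every vertex meets
-- each 2-factor twice, 2r ≤ s, and 2r < s when s is odd, so at most s + 1 colours are used.
-- The 2-colouring of an even 2-factor P is a solution over GF(2) of the linear system "the two
-- P-edges at each vertex get different bits". By the Fredholm alternative it is solvable, because a
-- vertex vector in the left kernel of the system is constant on cycles, and cycles have even length.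

module Submission where

open import Defs
open import Algebra.Bundles using (CommutativeRing)
import Algebra.Properties.CommutativeMonoid.Sum as CommutativeMonoidSum
import Algebra.Properties.Semiring.Sum as SemiringSum
open import Data.Bool using (Bool; true; false; not; _∧_; _xor_; if_then_else_)
open import Data.Bool.Properties
  using (xor-∧-commutativeRing; ∧-comm; ∧-assoc; ∧-identityʳ; ∧-zeroʳ; ∨-zeroʳ;
         ∧-distribˡ-xor; ∧-distribʳ-xor; xor-identityʳ; xor-same; ¬-not)
  renaming (_≟_ to _≟ᵇ_)
open import Data.Bool.Solver using (module xor-∧-Solver)
open import Data.Fin using (Fin; zero; suc; _≟_; toℕ; fromℕ<; combine; remQuot)
open import Data.Fin.Properties
  using (any?; all?; ¬∀⟶∃¬; pigeonhole; <⇒≢; toℕ-fromℕ<; toℕ-injective; toℕ<n; remQuot-combine)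
open import Data.Maybe using (Maybe; just; nothing; is-nothing)
open import Data.Maybe.Properties using (≡-dec)
open import Data.Nat using (ℕ; zero; suc; _+_; _*_; _%_; _≡ᵇ_; _≤_; _<_; z≤n; s≤s)
open import Data.Nat.DivMod using (m*n%n≡0)
open import Data.Nat.Properties
  using (+-suc; suc-injective; 0≢1+n; 1+n≢n; n<1+n; m<n⇒m<1+n; <-irrefl; <⇒≤; ≤∧≢⇒<;
         ≤-refl; ≤-reflexive; ≤-trans; +-mono-≤; +-0-commutativeMonoid; module ≤-Reasoning)
open import Data.Product using (_×_; _,_; proj₁; proj₂; ∃; map₂)
open import Data.Product.Properties using (,-injective)
open import Data.Sum using (inj₁; inj₂)
open import Data.Vec.Functional using (Vector; []; _∷_; transpose)
open import Function using (_∘_)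
open import Level using (0ℓ)
open import Relation.Binary.Core using (Rel)
open import Relation.Binary.Definitions using (Symmetric)
open import Relation.Binary.PropositionalEquality
open import Relation.Nullary using (¬_; ¬?; yes; no; does)
open import Relation.Nullary.Decidable
  using (⌊_⌋; dec-true; dec-false; decidable-stable; isYes≗does; ⌊⌋-map′)
open import Relation.Nullary.Negation using (contradiction)

open SemiringSum (CommutativeRing.semiring xor-∧-commutativeRing)
  using (sum; sum-cong-≗; ∑-distrib-+; ∑-comm; *-distribˡ-sum; *-distribʳ-sum; sum-replicate-zero)
module ℕΣ = CommutativeMonoidSum +-0-commutativeMonoid

-- Linear algebra over GF(2)

infixl 7 _·_

_·_ : ∀ {n} → Vector Bool n → Vector Bool n → Bool
u · v = sum (λ i → u i ∧ v i)

basis : ∀ {n} → Fin n → Vector Bool n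
basis p i = does (p ≟ i)

sum-zero : ∀ {n} (v : Vector Bool n) → (∀ i → v i ≡ false) → sum v ≡ false
sum-zero {n} v v≗0 = trans (sum-cong-≗ v≗0) (sum-replicate-zero n)

·-comm : ∀ {n} (u v : Vector Bool n) → u · v ≡ v · u
·-comm {n} u v = sum-cong-≗ {n} (λ i → ∧-comm (u i) (v i))

·-basisˡ : ∀ {n} (p : Fin n) (v : Vector Bool n) → basis p · v ≡ v p
·-basisˡ {suc n} zero    v =
  trans (cong (v zero xor_) (sum-zero {n} (λ _ → false) (λ _ → refl))) (xor-identityʳ (v zero))
·-basisˡ {suc n} (suc p) v = ·-basisˡ p (λ i → v (suc i))

·-distribʳ-xor : ∀ {n} (u v w : Vector Bool n) → (λ i → u i xor v i) · w ≡ u · w xor v · w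
·-distribʳ-xor {n} u v w =
  trans (sum-cong-≗ {n} (λ i → ∧-distribʳ-xor (w i) (u i) (v i)))
        (∑-distrib-+ (λ i → u i ∧ w i) (λ i → v i ∧ w i))

·-distribˡ-xor : ∀ {n} (u v w : Vector Bool n) → u · (λ i → v i xor w i) ≡ u · v xor u · w
·-distribˡ-xor {n} u v w =
  trans (sum-cong-≗ {n} (λ i → ∧-distribˡ-xor (u i) (v i) (w i)))
        (∑-distrib-+ (λ i → u i ∧ v i) (λ i → u i ∧ w i))

·-∧ˡ : ∀ {n} (c : Bool) (u v : Vector Bool n) → (λ i → c ∧ u i) · v ≡ c ∧ u · v
·-∧ˡ {n} c u v =
  trans (sum-cong-≗ {n} (λ i → ∧-assoc c (u i) (v i))) (sym (*-distribˡ-sum c (λ i → u i ∧ v i)))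

·-∧ʳ : ∀ {n} (c : Bool) (u v : Vector Bool n) → u · (λ i → v i ∧ c) ≡ u · v ∧ c
·-∧ʳ {n} c u v =
  trans (sum-cong-≗ {n} (λ i → sym (∧-assoc (u i) (v i) c))) (sym (*-distribʳ-sum c (λ i → u i ∧ v i)))

·-zeroʳ : ∀ {n} (u v : Vector Bool n) → (∀ i → v i ≡ false) → u · v ≡ false
·-zeroʳ u v v≗0 = sum-zero _ (λ i → trans (cong (u i ∧_) (v≗0 i)) (∧-zeroʳ (u i)))

·-basis-pair : ∀ {n} {e e' : Fin n} (u v : Vector Bool n) → (∀ f → u f ≡ basis e f xor basis e' f) →
               u · v ≡ v e xor v e'
·-basis-pair {n} {e} {e'} u v u≗pair = begin
  u · v                                       ≡⟨ sum-cong-≗ {n} (λ f → cong (_∧ v f) (u≗pair f)) ⟩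
  (λ f → basis e f xor basis e' f) · v        ≡⟨ ·-distribʳ-xor (basis e) (basis e') v ⟩
  basis e · v xor basis e' · v                ≡⟨ cong₂ _xor_ (·-basisˡ e v) (·-basisˡ e' v) ⟩
  v e xor v e'                                ∎
  where open ≡-Reasoning

xor≡false⇒≡ : ∀ {a b} → a xor b ≡ false → a ≡ b
xor≡false⇒≡ {false}         eq = sym eq
xor≡false⇒≡ {true}  {true}  _  = refl
xor≡false⇒≡ {true}  {false} ()

back-substitution : ∀ a bp r s bi → s xor a ∧ r ≡ bi xor a ∧ bp → a ∧ (bp xor r) xor s ≡ bi
back-substitution a bp r s bi eq = begin
  a ∧ (bp xor r) xor s                             ≡⟨ cong (a ∧ (bp xor r) xor_) s≡ ⟩
  a ∧ (bp xor r) xor ((bi xor a ∧ bp) xor a ∧ r)   ≡⟨ eliminate a bp r bi ⟩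
  bi                                               ∎
  where
  open ≡-Reasoning
  open xor-∧-Solver
  s≡ : s ≡ (bi xor a ∧ bp) xor a ∧ r
  s≡ = trans (solve 3 (λ a r s → s := (s :+ a :* r) :+ a :* r) refl a r s) (cong (_xor a ∧ r) eq)
  eliminate : ∀ a bp r bi → a ∧ (bp xor r) xor ((bi xor a ∧ bp) xor a ∧ r) ≡ bi
  eliminate = solve 4 (λ a bp r bi → a :* (bp :+ r) :+ ((bi :+ a :* bp) :+ a :* r) := bi) refl

Consistent : ∀ {R C} → Vector (Vector Bool C) R → Vector Bool R → Set
Consistent A b = ∀ y → (∀ j → y · transpose A j ≡ false) → y · b ≡ false

fredholm : ∀ {R C} (A : Vector (Vector Bool C) R) (b : Vector Bool R) →
           Consistent A b → ∃ λ x → ∀ i → A i · x ≡ b i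
fredholm {C = zero} A b consistent =
  [] , λ i → sym (trans (sym (·-basisˡ i b)) (consistent (basis i) (λ ())))
fredholm {C = suc C} A b consistent with any? (λ p → A p zero ≟ᵇ true)
... | no noPivot = false ∷ x′ , solves
  where
  A′ = λ i j → A i (suc j)
  solution = fredholm A′ b λ y y⊥A′ → consistent y λ
    { zero    → ·-zeroʳ y _ (λ p → ¬-not (λ ap → noPivot (p , ap)))
    ; (suc j) → y⊥A′ j }
  x′ = proj₁ solution
  solves : ∀ i → A i zero ∧ false xor A′ i · x′ ≡ b i
  solves i = trans (cong (_xor A′ i · x′) (∧-zeroʳ (A i zero))) (proj₂ solution i)
-- Gaussian elimination of the first column with pivot row p. A vector y in the left kernel of the
-- reduced system A″ lifts to the vector y* = y + (y · a) eₚ in the left kernel of A.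
... | yes (p , pivot) = (b p xor A′ p · x′) ∷ x′ , solves
  where
  a  = λ i → A i zero
  A′ = λ i j → A i (suc j)
  A″ = λ i j → A′ i j xor a i ∧ A′ p j
  b″ = λ i → b i xor a i ∧ b p
  consistent″ : Consistent A″ b″
  consistent″ y y⊥A″ = begin
    y · b″                   ≡⟨ y·[g+ca] b (b p) ⟩
    y · b xor t ∧ b p        ≡⟨ sym (y*· b) ⟩
    y* · b                   ≡⟨ consistent y* y*⊥A ⟩
    false                    ∎
    where
    open ≡-Reasoning
    t  = y · a
    y* = λ i → y i xor t ∧ basis p i
    y*· : ∀ g → y* · g ≡ y · g xor t ∧ g p
    y*· g = trans (·-distribʳ-xor y (λ i → t ∧ basis p i) g)
              (cong (y · g xor_) (trans (·-∧ˡ t (basis p) g) (cong (t ∧_) (·-basisˡ p g))))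
    y·[g+ca] : ∀ g c → y · (λ i → g i xor a i ∧ c) ≡ y · g xor t ∧ c
    y·[g+ca] g c = trans (·-distribˡ-xor y g (λ i → a i ∧ c)) (cong (y · g xor_) (·-∧ʳ c y a))
    y*⊥A : ∀ j → y* · transpose A j ≡ false
    y*⊥A zero    = begin
      y* · a           ≡⟨ y*· a ⟩
      t xor t ∧ a p    ≡⟨ cong (λ z → t xor t ∧ z) pivot ⟩
      t xor t ∧ true   ≡⟨ cong (t xor_) (∧-identityʳ t) ⟩
      t xor t          ≡⟨ xor-same t ⟩
      false            ∎
    y*⊥A (suc j) = begin
      y* · transpose A′ j                      ≡⟨ y*· (transpose A′ j) ⟩
      y · transpose A′ j xor t ∧ A′ p j        ≡⟨ sym (y·[g+ca] (transpose A′ j) (A′ p j)) ⟩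
      y · transpose A″ j                       ≡⟨ y⊥A″ j ⟩
      false                                    ∎
  solution = fredholm A″ b″ consistent″
  x′ = proj₁ solution
  solves : ∀ i → a i ∧ (b p xor A′ p · x′) xor A′ i · x′ ≡ b i
  solves i = back-substitution (a i) (b p) (A′ p · x′) (A′ i · x′) (b i) (trans (sym row) (proj₂ solution i))
    where
    row : A″ i · x′ ≡ A′ i · x′ xor a i ∧ A′ p · x′
    row = trans (·-distribʳ-xor (A′ i) (λ j → a i ∧ A′ p j) x′)
                (cong (A′ i · x′ xor_) (·-∧ˡ (a i) (A′ p) x′))

-- Counting and parity

_∖_ : ∀ {k} → Vector Bool k → Fin k → Vector Bool k
(q ∖ e) f = if basis e f then false else q f

basis-≢ : ∀ {n} {p i : Fin n} → p ≢ i → basis p i ≡ false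
basis-≢ {p = p} {i} p≢i = dec-false (p ≟ i) p≢i

∖-≢ : ∀ {k} (q : Vector Bool k) {e f} → e ≢ f → (q ∖ e) f ≡ q f
∖-≢ q {f = f} e≢f = cong (if_then false else q f) (basis-≢ e≢f)

count-∖ : ∀ {k} (q : Vector Bool k) {e} → q e ≡ true → count q ≡ suc (count (q ∖ e))
count-∖ {suc k} q {zero}  qe rewrite qe = refl
count-∖ {suc k} q {suc e} qe =
  trans (cong ((if q zero then 1 else 0) +_) (count-∖ (λ i → q (suc i)) qe)) (+-suc _ _)

count≡0⇒false : ∀ {k} (q : Vector Bool k) → count q ≡ 0 → ∀ f → q f ≡ false
count≡0⇒false q c0 f = ¬-not (λ qf → 0≢1+n (trans (sym c0) (count-∖ q qf)))

count≡suc⇒∃ : ∀ {k n} (q : Vector Bool k) → count q ≡ suc n → ∃ λ e → q e ≡ true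
count≡suc⇒∃ {suc k} q c with q zero in q0
... | true  = zero , q0
... | false = let (e , qe) = count≡suc⇒∃ (λ i → q (suc i)) c in suc e , qe

count≡1⇒unique : ∀ {k} (q : Vector Bool k) → count q ≡ 1 →
                 ∀ {e f} → q e ≡ true → q f ≡ true → e ≡ f
count≡1⇒unique q c1 {e} {f} qe qf with e ≟ f
... | yes e≡f = e≡f
... | no  e≢f = contradiction (trans (sym qf) (trans (sym (∖-≢ q e≢f)) (count≡0⇒false (q ∖ e) c0 f)))
                             λ ()
  where
  c0 : count (q ∖ e) ≡ 0
  c0 = suc-injective (trans (sym (count-∖ q qe)) c1)

count≡2⇒pair : ∀ {k} (q : Vector Bool k) → count q ≡ 2 → ∀ {e e'} → q e ≡ true → q e' ≡ true →
               e ≢ e' → ∀ f → q f ≡ basis e f xor basis e' f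
count≡2⇒pair q c2 {e} {e'} qe qe' e≢e' f with e ≟ f | e' ≟ f
... | yes refl | yes refl = contradiction refl e≢e'
... | yes refl | no _     = qe
... | no _     | yes refl = qe'
... | no e≢f   | no e'≢f  = ¬-not f∉q
  where
  c1 : count (q ∖ e) ≡ 1
  c1 = suc-injective (trans (sym (count-∖ q qe)) c2)
  f∉q : q f ≢ true
  f∉q qf = e'≢f (count≡1⇒unique (q ∖ e) c1 (trans (∖-≢ q e≢e') qe') (trans (∖-≢ q e≢f) qf))

count-false : ∀ {k} → count {k} (λ _ → false) ≡ 0
count-false {zero}  = refl
count-false {suc k} = count-false {k}

count-cong : ∀ {k} {p q : Vector Bool k} → (∀ i → p i ≡ q i) → count p ≡ count q
count-cong {zero}  p≗q = refl
count-cong {suc k} p≗q = cong₂ _+_ (cong (if_then 1 else 0) (p≗q zero)) (count-cong (p≗q ∘ suc))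

count-basis : ∀ {k} (p : Fin k) → count (basis p) ≡ 1
count-basis {suc k} zero    = cong suc (count-false {k})
count-basis {suc k} (suc p) = count-basis p

-- suc (suc n) % 2 reduces to n % 2 by computation.
%2-suc : ∀ n → (suc n % 2 ≡ᵇ 1) ≡ not (n % 2 ≡ᵇ 1)
%2-suc zero          = refl
%2-suc (suc zero)    = refl
%2-suc (suc (suc n)) = %2-suc n

sum≡parity : ∀ {k} (q : Vector Bool k) → sum q ≡ (count q % 2 ≡ᵇ 1)
sum≡parity {zero}  q = refl
sum≡parity {suc k} q with q zero
... | true  = trans (cong not (sum≡parity (λ i → q (suc i)))) (sym (%2-suc (count (λ i → q (suc i)))))
... | false = sum≡parity (λ i → q (suc i))

sum-even-fibres : ∀ {n j} (ℓ : Fin n → Fin j) (f : Vector Bool j) →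
                  (∀ i → sum (λ v → basis (ℓ v) i) ≡ false) → sum (λ v → f (ℓ v)) ≡ false
sum-even-fibres {n} ℓ f even = begin
  sum (λ v → f (ℓ v))
    ≡⟨ sum-cong-≗ {n} (λ v → sym (·-basisˡ (ℓ v) f)) ⟩
  sum (λ v → sum (λ i → basis (ℓ v) i ∧ f i))
    ≡⟨ ∑-comm (λ v i → basis (ℓ v) i ∧ f i) ⟩
  sum (λ i → sum (λ v → basis (ℓ v) i ∧ f i))
    ≡⟨ sum-cong-≗ (λ i → sym (*-distribʳ-sum (f i) (λ v → basis (ℓ v) i))) ⟩
  sum (λ i → sum (λ v → basis (ℓ v) i) ∧ f i)
    ≡⟨ sum-zero _ (λ i → cong (_∧ f i) (even i)) ⟩
  false
    ∎
  where open ≡-Reasoning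

∑-indicator≡count : ∀ {r} (b : Vector Bool r) → ℕΣ.sum (λ i → if b i then 1 else 0) ≡ count b
∑-indicator≡count {zero}  b = refl
∑-indicator≡count {suc r} b = cong ((if b zero then 1 else 0) +_) (∑-indicator≡count (b ∘ suc))

count-∧ʳ-≤ : ∀ {k} (p : Vector Bool k) b → count p ≤ 1 → count (λ i → p i ∧ b) ≤ (if b then 1 else 0)
count-∧ʳ-≤     p true  p≤1 = ≤-trans (≤-reflexive (count-cong (λ i → ∧-identityʳ (p i)))) p≤1
count-∧ʳ-≤ {k} p false _ = ≤-reflexive (trans (count-cong (λ i → ∧-zeroʳ (p i))) (count-false {k}))

∑-count-≤ : ∀ {r k} (P : Fin r → Vector Bool k) (q : Vector Bool k) →
            (∀ e → count (λ i → P i e) ≤ 1) → ℕΣ.sum (λ i → count (λ e → P i e ∧ q e)) ≤ count q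
∑-count-≤ {r} {zero}  P q _ = ≤-reflexive (ℕΣ.sum-replicate-zero r)
∑-count-≤ {r} {suc k} P q disjoint = begin
  ℕΣ.sum (λ i → firstEdge i + otherEdges i)
    ≡⟨ ℕΣ.∑-distrib-+ firstEdge otherEdges ⟩
  ℕΣ.sum firstEdge + ℕΣ.sum otherEdges
    ≡⟨ cong (_+ ℕΣ.sum otherEdges) (∑-indicator≡count (λ i → P i zero ∧ q zero)) ⟩
  count (λ i → P i zero ∧ q zero) + ℕΣ.sum otherEdges
    ≤⟨ +-mono-≤ (count-∧ʳ-≤ (λ i → P i zero) (q zero) (disjoint zero))
                (∑-count-≤ (λ i → P i ∘ suc) (q ∘ suc) (disjoint ∘ suc)) ⟩
  (if q zero then 1 else 0) + count (q ∘ suc)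
    ∎
  where
  open ≤-Reasoning
  firstEdge otherEdges : Fin r → ℕ
  firstEdge  i = if P i zero ∧ q zero then 1 else 0
  otherEdges i = count (λ e → P i (suc e) ∧ q (suc e))

∑-const : ∀ r c → ℕΣ.sum {r} (λ _ → c) ≡ r * c
∑-const zero    c = refl
∑-const (suc r) c = cong (c +_) (∑-const r c)

even<odd : ∀ k {s} → k * 2 ≤ s → s % 2 ≡ 1 → k * 2 < s
even<odd k k*2≤s odd =
  ≤∧≢⇒< k*2≤s λ k*2≡s → 0≢1+n (trans (sym (m*n%n≡0 k 2)) (trans (cong (_% 2) k*2≡s) odd))

-- Greedy colouring

no-surjection : ∀ {d} (f : Fin d → Fin (suc d)) → ¬ (∀ c → ∃ λ k → f k ≡ c)
no-surjection {d} f hit with pigeonhole (n<1+n d) (proj₁ ∘ hit)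
... | i , j , i<j , same = <⇒≢ i<j (begin
  i                  ≡⟨ sym (proj₂ (hit i)) ⟩
  f (proj₁ (hit i))  ≡⟨ cong f same ⟩
  f (proj₁ (hit j))  ≡⟨ proj₂ (hit j) ⟩
  j                  ∎)
  where open ≡-Reasoning

free-colour : ∀ {d} (f : Fin d → Fin (suc d)) → ∃ λ c → ∀ k → f k ≢ c
free-colour {d} f with any? (λ c → all? (λ k → ¬? (f k ≟ c)))
... | yes avoided = avoided
... | no  none    = contradiction hit (no-surjection f)
  where
  hit : ∀ c → ∃ λ k → f k ≡ c
  hit c = map₂ (λ {k} → decidable-stable (f k ≟ c))
               (¬∀⟶∃¬ d (λ k → f k ≢ c) (λ k → ¬? (f k ≟ c)) (λ avoids → none (c , avoids)))

greedy-colouring : ∀ {M d} (_~_ : Rel (Fin M) 0ℓ) → Symmetric _~_ → (∀ {e} → ¬ e ~ e) →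
                   (∀ e → ∃ λ (nb : Fin d → Fin M) → ∀ {e'} → e ~ e' → ∃ λ k → nb k ≡ e') →
                   ∃ λ (col : Fin M → Fin (suc d)) → ∀ {e e'} → e ~ e' → col e ≢ col e'
greedy-colouring {zero}      _~_ ~-sym ~-irrefl neighbours = (λ ()) , λ { {()} }
greedy-colouring {suc M} {d} _~_ ~-sym ~-irrefl neighbours = col , proper
  where
  neighbours′ : ∀ e → ∃ λ (nb : Fin d → Fin M) → ∀ {e'} → suc e ~ suc e' → ∃ λ k → nb k ≡ e'
  neighbours′ e = shrink ∘ proj₁ (neighbours (suc e)) , map₂ (cong shrink) ∘ proj₂ (neighbours (suc e))
    where
    shrink : Fin (suc M) → Fin M
    shrink zero    = e
    shrink (suc x) = x
  coloured = greedy-colouring (λ e e' → suc e ~ suc e') ~-sym ~-irrefl neighbours′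
  -- Neighbour slots pointing at zero carry no information: for suc e they are not neighbours in the
  -- remaining relation (shrink zero), and zero is not its own neighbour (old zero).
  old : Fin (suc M) → Fin (suc d)
  old zero    = zero
  old (suc x) = proj₁ coloured x
  fresh = free-colour (old ∘ proj₁ (neighbours zero))
  col : Fin (suc M) → Fin (suc d)
  col zero    = proj₁ fresh
  col (suc x) = proj₁ coloured x
  fresh-proper : ∀ {e} → zero ~ suc e → col zero ≢ col (suc e)
  fresh-proper 0~e with proj₂ (neighbours zero) 0~e
  ... | k , nbk≡e = ≢-sym (subst (λ x → old x ≢ proj₁ fresh) nbk≡e (proj₂ fresh k))
  proper : ∀ {e e'} → e ~ e' → col e ≢ col e'
  proper {zero}  {zero}   e~e' = contradiction e~e' ~-irrefl
  proper {zero}  {suc e'} e~e' = fresh-proper e~e'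
  proper {suc e} {zero}   e~e' = ≢-sym (fresh-proper (~-sym e~e'))
  proper {suc e} {suc e'} e~e' = proj₂ coloured e~e'

-- Edge colourings of 2-factors

Adjacent : (G : Graph) → EdgeSet G → Rel (Fin (m G)) 0ℓ
Adjacent G P e e' = P e ≡ true × P e' ≡ true × e ≢ e' × ∃ λ v → Incident G v e × Incident G v e'

ProperOn : ∀ {A : Set} (G : Graph) → EdgeSet G → (Fin (m G) → A) → Set
ProperOn G P col = ∀ {e e'} → Adjacent G P e e' → col e ≢ col e'

adjacent-sym : ∀ {G : Graph} {P : EdgeSet G} → Symmetric (Adjacent G P)
adjacent-sym (Pe , Pe' , e≢e' , v , ve , ve') = Pe' , Pe , ≢-sym e≢e' , v , ve' , ve

adjacent-irrefl : ∀ {G : Graph} {P : EdgeSet G} {e} → ¬ Adjacent G P e e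
adjacent-irrefl (_ , _ , e≢e , _) = e≢e refl

incident⇒incidentB : (G : Graph) {v : Fin (n G)} {e : Fin (m G)} → Incident G v e → incidentB G v e ≡ true
incident⇒incidentB G {v} {e} (inj₁ u≡v) with proj₁ (ends G e) ≟ v
... | yes _   = refl
... | no  u≢v = contradiction u≡v u≢v
incident⇒incidentB G {v} {e} (inj₂ w≡v) with proj₂ (ends G e) ≟ v
... | yes _   = ∨-zeroʳ _
... | no  w≢v = contradiction w≡v w≢v

incidentB≡basis-pair : (G : Graph) (v : Fin (n G)) (e : Fin (m G)) →
                       incidentB G v e ≡ basis (proj₁ (ends G e)) v xor basis (proj₂ (ends G e)) v
incidentB≡basis-pair G v e with proj₁ (ends G e) ≟ v | proj₂ (ends G e) ≟ v
... | yes u≡v | yes w≡v = contradiction (trans u≡v (sym w≡v)) (noLoop G e)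
... | yes _   | no  _   = refl
... | no  _   | yes _   = refl
... | no  _   | no  _   = refl

module _ (G : Graph) (P : EdgeSet G) (twoFactor : IsTwoFactor G P) where

  counted-at : ∀ {v e} → P e ≡ true → Incident G v e → P e ∧ incidentB G v e ≡ true
  counted-at Pe ve = cong₂ _∧_ Pe (incident⇒incidentB G ve)

  other-edge : ∀ {v e} → P e ≡ true → Incident G v e →
               ∃ λ o → ∀ {e'} → P e' ≡ true → Incident G v e' → e ≢ e' → o ≡ e'
  other-edge {v} {e} Pe ve = proj₁ found , λ Pe' ve' e≢e' →
    count≡1⇒unique (q ∖ e) c1 (proj₂ found) (trans (∖-≢ q e≢e') (counted-at Pe' ve'))
    where
    q = λ f → P f ∧ incidentB G v f
    c1 : count (q ∖ e) ≡ 1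
    c1 = suc-injective (trans (sym (count-∖ q (counted-at Pe ve))) (twoFactor v))
    found = count≡suc⇒∃ (q ∖ e) c1

  twoFactor-neighbours : ∀ e → ∃ λ (nb : Fin 2 → Fin (m G)) →
                         ∀ {e'} → Adjacent G P e e' → ∃ λ k → nb k ≡ e'
  twoFactor-neighbours e with P e ≟ᵇ true
  ... | no ¬Pe = (λ _ → e) , λ adj → contradiction (proj₁ adj) ¬Pe
  ... | yes Pe = proj₁ at-u ∷ proj₁ at-w ∷ [] , neighbour
    where
    at-u = other-edge Pe (inj₁ refl)
    at-w = other-edge Pe (inj₂ refl)
    neighbour : ∀ {e'} → Adjacent G P e e' → ∃ λ k → (proj₁ at-u ∷ proj₁ at-w ∷ []) k ≡ e'
    neighbour {e'} (_ , Pe' , e≢e' , v , inj₁ u≡v , ve') =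
      zero , proj₂ at-u Pe' (subst (λ x → Incident G x e') (sym u≡v) ve') e≢e'
    neighbour {e'} (_ , Pe' , e≢e' , v , inj₂ w≡v , ve') =
      suc zero , proj₂ at-w Pe' (subst (λ x → Incident G x e') (sym w≡v) ve') e≢e'

  twoFactor-3-colourable : ∃ λ (col : Fin (m G) → Fin 3) → ProperOn G P col
  twoFactor-3-colourable =
    greedy-colouring (Adjacent G P) (adjacent-sym {G} {P}) (adjacent-irrefl {G} {P}) twoFactor-neighbours

  evenTwoFactor-2-colourable : NumOddCycles G P 0 → ∃ λ (col : Fin (m G) → Bool) → ProperOn G P col
  evenTwoFactor-2-colourable (_ , c , noOddCycle) = x , proper
    where
    A : Vector (Vector Bool (m G)) (n G)
    A v e = P e ∧ incidentB G v e

    even-components : ∀ i → sum (λ v → basis (label c v) i) ≡ false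
    even-components i = begin
      sum (λ v → basis (label c v) i)          ≡⟨ sum-cong-≗ {n G} (λ v → sym (isYes≗does (label c v ≟ i))) ⟩
      sum (λ v → ⌊ label c v ≟ i ⌋)            ≡⟨ sum≡parity (λ v → ⌊ label c v ≟ i ⌋) ⟩
      count (λ v → ⌊ label c v ≟ i ⌋) % 2 ≡ᵇ 1 ≡⟨ count≡0⇒false odd noOddCycle i ⟩
      false                                    ∎
      where
      open ≡-Reasoning
      odd = λ i → count (λ v → ⌊ label c v ≟ i ⌋) % 2 ≡ᵇ 1

    consistent : Consistent A (λ _ → true)
    consistent y y⊥A = begin
      y · (λ _ → true)                  ≡⟨ sum-cong-≗ {n G} (λ v → trans (∧-identityʳ (y v)) (y-on-component v)) ⟩
      sum (λ v → y (root (label c v)))  ≡⟨ sum-even-fibres (label c) (y ∘ root) even-components ⟩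
      false                             ∎
      where
      open ≡-Reasoning
      root : _ → Fin (n G)
      root i = proj₁ (onto c i)
      y-edge : ∀ {e} → P e ≡ true → y (proj₁ (ends G e)) ≡ y (proj₂ (ends G e))
      y-edge {e} Pe = xor≡false⇒≡ (begin
        y (proj₁ (ends G e)) xor y (proj₂ (ends G e))  ≡⟨ sym (·-basis-pair (transpose A e) y column) ⟩
        transpose A e · y                            ≡⟨ ·-comm (transpose A e) y ⟩
        y · transpose A e                            ≡⟨ y⊥A e ⟩
        false                                        ∎)
        where
        column : ∀ v → P e ∧ incidentB G v e ≡ _
        column v = trans (cong (_∧ incidentB G v e) Pe) (incidentB≡basis-pair G v e)
      y-reach : ∀ {u v} → Reach G P u v → y u ≡ y v
      y-reach here = refl
      y-reach (step e Pe (inj₁ (u≡ , w≡)) r) =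
        trans (subst₂ (λ a b → y a ≡ y b) u≡ w≡ (y-edge Pe)) (y-reach r)
      y-reach (step e Pe (inj₂ (u≡ , w≡)) r) =
        trans (subst₂ (λ a b → y a ≡ y b) u≡ w≡ (sym (y-edge Pe))) (y-reach r)
      y-on-component : ∀ v → y v ≡ y (root (label c v))
      y-on-component v = sym (y-reach (sound c _ v (proj₂ (onto c (label c v)))))

    solution = fredholm A (λ _ → true) consistent
    x = proj₁ solution

    proper : ProperOn G P x
    proper {e} {e'} (Pe , Pe' , e≢e' , v , ve , ve') xe≡xe' = contradiction (begin
      true          ≡⟨ sym (proj₂ solution v) ⟩
      A v · x       ≡⟨ ·-basis-pair (A v) x edges-at-v ⟩
      x e xor x e'  ≡⟨ cong (x e xor_) (sym xe≡xe') ⟩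
      x e xor x e   ≡⟨ xor-same (x e) ⟩
      false         ∎) λ ()
      where
      open ≡-Reasoning
      edges-at-v = count≡2⇒pair (A v) (twoFactor v) (counted-at Pe ve) (counted-at Pe' ve') e≢e'

-- Colouring a factorisation

factors-disjoint : ∀ {G s} (F : Factorization G s) e → count (λ i → factor F i e) ≤ 1
factors-disjoint F e with assign F e
... | nothing = ≤-trans (≤-reflexive (count-false {r F})) z≤n
... | just j  = ≤-reflexive (trans (count-cong factor≗basis) (count-basis j))
  where
  factor≗basis : ∀ i → ⌊ ≡-dec _≟_ (just j) (just i) ⌋ ≡ basis j i
  factor≗basis i = trans (⌊⌋-map′ _ _ (j ≟ i)) (isYes≗does (j ≟ i))

r*2≤s : ∀ {G s} → Regular G s → (F : Factorization G s) → Fin (n G) → r F * 2 ≤ s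
r*2≤s {G} {s} regular F v = begin
  r F * 2                                      ≡⟨ sym (∑-const (r F) 2) ⟩
  ℕΣ.sum {r F} (λ _ → 2)                       ≡⟨ ℕΣ.sum-cong-≗ {r F} (λ i → sym (factors2 F i v)) ⟩
  ℕΣ.sum (λ i → degIn G (factor F i) v)        ≤⟨ ∑-count-≤ (factor F) (incidentB G v) (factors-disjoint F) ⟩
  count (incidentB G v)                        ≡⟨ regular v ⟩
  s                                            ∎
  where open ≤-Reasoning

unassigned⇒odd : ∀ {G s} (F : Factorization G s) {e} → assign F e ≡ nothing →
                 s % 2 ≡ 1 × IsOneFactor G (λ e → is-nothing (assign F e))
unassigned⇒odd F eq with rest F
... | inj₁ (_ , allAssigned) = contradiction eq (allAssigned _)
... | inj₂ odd               = odd

assigned⇒factor : ∀ {G s} (F : Factorization G s) {e i} → assign F e ≡ just i → factor F i e ≡ true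
assigned⇒factor F {e} {i} eq = trans (isYes≗does assigned?) (dec-true assigned? eq)
  where assigned? = ≡-dec _≟_ (assign F e) (just i)

colourable-from-ℕ : ∀ (G : Graph) {c} (col : Fin (m G) → ℕ) → (∀ e → col e < c) →
                    ProperOn G (allEdges G) col → EdgeColourable G c
colourable-from-ℕ G col bounded proper =
  (λ e → fromℕ< (bounded e)) ,
  λ e e' e≢e' (v , ve , ve') same → proper (refl , refl , e≢e' , v , ve , ve') (begin
    col e                     ≡⟨ sym (toℕ-fromℕ< (bounded e)) ⟩
    toℕ (fromℕ< (bounded e))  ≡⟨ cong toℕ same ⟩
    toℕ (fromℕ< (bounded e')) ≡⟨ toℕ-fromℕ< (bounded e') ⟩
    col e'                    ∎)
  where open ≡-Reasoning

data Colour (r : ℕ) : Set where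
  paired  : Fin r → Bool → Colour r
  spare   : Colour r
  matched : Colour r

paired-injectiveʳ : ∀ {r} {i i' : Fin r} {b b'} → paired i b ≡ paired i' b' → b ≡ b'
paired-injectiveʳ refl = refl

bit : Bool → Fin 2
bit false = zero
bit true  = suc zero

bit-injective : ∀ {b b'} → bit b ≡ bit b' → b ≡ b'
bit-injective {false} {false} _ = refl
bit-injective {true}  {true}  _ = refl

combine-injective : ∀ {r k} {i i' : Fin r} {j j' : Fin k} → combine i j ≡ combine i' j' → i ≡ i' × j ≡ j'
combine-injective {k = k} {i} {i'} {j} {j'} eq =
  ,-injective (trans (sym (remQuot-combine i j)) (trans (cong (remQuot k) eq) (remQuot-combine i' j')))

encode : ∀ {r} → Colour r → ℕ
encode     (paired i b) = toℕ (combine i (bit b))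
encode {r} spare        = r * 2
encode {r} matched      = suc (r * 2)

encode-injective : ∀ {r} {c c' : Colour r} → encode c ≡ encode c' → c ≡ c'
encode-injective {c = paired i b} {paired i' b'} eq
  with combine-injective (toℕ-injective eq)
... | i≡i' , bit≡ = cong₂ paired i≡i' (bit-injective bit≡)
encode-injective {c = paired i b} {spare}        eq = contradiction (toℕ<n _) (<-irrefl eq)
encode-injective {c = paired i b} {matched}      eq = contradiction (m<n⇒m<1+n (toℕ<n _)) (<-irrefl eq)
encode-injective {c = spare}      {paired i b}   eq = contradiction (toℕ<n _) (<-irrefl (sym eq))
encode-injective {c = spare}      {spare}        _  = refl
encode-injective {c = spare}      {matched}      eq = contradiction (sym eq) 1+n≢n
encode-injective {c = matched}    {paired i b}   eq = contradiction (m<n⇒m<1+n (toℕ<n _)) (<-irrefl (sym eq))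
encode-injective {c = matched}    {spare}        eq = contradiction eq 1+n≢n
encode-injective {c = matched}    {matched}      _  = refl

module _ {G : Graph} {s : ℕ} (regular : Regular G s) (F : Factorization G s) (i₀ : Fin (r F))
         (evenElsewhere : ∀ i → i ≢ i₀ → NumOddCycles G (factor F i) 0) where

  -- The class of the factorisation (a 2-factor, or nothing for the 1-factor) allowed to use a colour;
  -- colour classes are therefore never shared between classes of the factorisation.
  owner : Colour (r F) → Maybe (Fin (r F))
  owner (paired i _) = just i
  owner spare        = just i₀
  owner matched      = nothing

  encode-owned : ∀ {c i} → owner c ≡ just i → encode c ≤ r F * 2
  encode-owned {paired i b} _ = <⇒≤ (toℕ<n (combine i (bit b)))
  encode-owned {spare}      _ = ≤-refl

  spread : Fin 3 → Colour (r F)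
  spread zero             = paired i₀ false
  spread (suc zero)       = paired i₀ true
  spread (suc (suc zero)) = spare

  spread-injective : ∀ {c c'} → spread c ≡ spread c' → c ≡ c'
  spread-injective {zero}             {zero}             _ = refl
  spread-injective {suc zero}         {suc zero}         _ = refl
  spread-injective {suc (suc zero)}   {suc (suc zero)}   _ = refl
  spread-injective {zero}             {suc zero}         ()
  spread-injective {zero}             {suc (suc zero)}   ()
  spread-injective {suc zero}         {zero}             ()
  spread-injective {suc zero}         {suc (suc zero)}   ()
  spread-injective {suc (suc zero)}   {zero}             ()
  spread-injective {suc (suc zero)}   {suc zero}         ()

  spread-owner : ∀ c → owner (spread c) ≡ just i₀
  spread-owner zero             = refl
  spread-owner (suc zero)       = refl
  spread-owner (suc (suc zero)) = refl

  threeColouring : ∃ λ (col : Fin (m G) → Fin 3) → ProperOn G (factor F i₀) col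
  threeColouring = twoFactor-3-colourable G (factor F i₀) (factors2 F i₀)

  twoColouring : ∀ i → i ≢ i₀ → ∃ λ (col : Fin (m G) → Bool) → ProperOn G (factor F i) col
  twoColouring i i≢i₀ = evenTwoFactor-2-colourable G (factor F i) (factors2 F i) (evenElsewhere i i≢i₀)

  colourIn : Fin (r F) → Fin (m G) → Colour (r F)
  colourIn i with i ≟ i₀
  ... | yes refl = spread ∘ proj₁ threeColouring
  ... | no i≢i₀  = paired i ∘ proj₁ (twoColouring i i≢i₀)

  colourIn-owner : ∀ i e → owner (colourIn i e) ≡ just i
  colourIn-owner i e with i ≟ i₀
  ... | yes refl = spread-owner _
  ... | no _     = refl

  colourIn-proper : ∀ i → ProperOn G (factor F i) (colourIn i)
  colourIn-proper i adj with i ≟ i₀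
  ... | yes refl = proj₂ threeColouring adj ∘ spread-injective
  ... | no i≢i₀  = proj₂ (twoColouring i i≢i₀) adj ∘ paired-injectiveʳ

  colourOf : Fin (m G) → Maybe (Fin (r F)) → Colour (r F)
  colourOf e (just i) = colourIn i e
  colourOf e nothing  = matched

  owner-colourOf : ∀ e x → owner (colourOf e x) ≡ x
  owner-colourOf e (just i) = colourIn-owner i e
  owner-colourOf e nothing  = refl

  matched-unique : ∀ {e e' v} → assign F e ≡ nothing → assign F e' ≡ nothing →
                   Incident G v e → Incident G v e' → e ≡ e'
  matched-unique {e} {e'} {v} eq eq' ve ve' =
    count≡1⇒unique (λ f → is-nothing (assign F f) ∧ incidentB G v f) (proj₂ (unassigned⇒odd F eq) v)
      (cong₂ _∧_ (cong is-nothing eq) (incident⇒incidentB G ve))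
      (cong₂ _∧_ (cong is-nothing eq') (incident⇒incidentB G ve'))

  colourOf-proper : ∀ {e e'} x x' → assign F e ≡ x → assign F e' ≡ x' →
                    Adjacent G (allEdges G) e e' → colourOf e x ≢ colourOf e' x'
  colourOf-proper {e} {e'} x x' _ _ _ same
    with trans (sym (owner-colourOf e x)) (trans (cong owner same) (owner-colourOf e' x'))
  colourOf-proper (just i) _ eq eq' (_ , _ , e≢e' , v , ve , ve') same | refl =
    colourIn-proper i (assigned⇒factor F eq , assigned⇒factor F eq' , e≢e' , v , ve , ve') same
  colourOf-proper nothing  _ eq eq' (_ , _ , e≢e' , v , ve , ve') same | refl =
    e≢e' (matched-unique eq eq' ve ve')

  colourOf-bound : ∀ e x → assign F e ≡ x → encode (colourOf e x) < suc s
  colourOf-bound e (just i) _  =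
    s≤s (≤-trans (encode-owned (colourIn-owner i e)) (r*2≤s regular F (proj₁ (ends G e))))
  colourOf-bound e nothing  eq =
    s≤s (even<odd (r F) (r*2≤s regular F (proj₁ (ends G e))) (proj₁ (unassigned⇒odd F eq)))

  colourable : EdgeColourable G (suc s)
  colourable = colourable-from-ℕ G (λ e → encode (colourOf e (assign F e)))
    (λ e → colourOf-bound e (assign F e) refl)
    (λ adj → colourOf-proper _ _ refl refl adj ∘ encode-injective)

lemma2p4 : (G : Graph) (s : ℕ) → Connected G → Regular G s →
    (F : Factorization G s) (k : ℕ) → OddTotal F k →
    (∀ (F' : Factorization G s) (k' : ℕ) → OddTotal F' k' → k ≤ k') →
    (i₀ : Fin (r F)) → (∀ i → i ≢ i₀ → NumOddCycles G (factor F i) 0) →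
    EdgeColourable G (suc s)
lemma2p4 G s _ regular F _ _ _ i₀ evenElsewhere = colourable regular F i₀ evenElsewhere
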